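{- For every $\varepsilon>0$ and every positive integer $r$ there exists $n_0>0$ such that the following holds for every integer $n\ge n_0$. Let $A_1,\ldots,A_r$ be maximal sum-free subsets of $[n]$, let $C\subseteq[r]$ be such that $A_i$ is of type (a) for every $i\in C$ and of type (b) or (c) for every $i\in[r]\setminus C$, and let $a=\frac1n\sum_{i\in[r]\setminus C}\left(\lceil n/2\rceil-|A_i|\right)$ (so $an$ is an integer). Let $J_3=[\lfloor n/2\rfloor-an+1,\lfloor n/2\rfloor]$ and $I_2=[\lfloor n/2\rfloor+1,n]$. Suppose that for some positive integer $k\le r$ the sets $A_1,\ldots,A_k$ are of type (c) and $[k]\cap C=\emptyset$, and let $q_i=d(A_i\cap J_3)$ for $i\in[k]$. Then $$\sum_{i\in[k]}q_i\le a+\varepsilon\qquad\text{and}\qquad d\Big(\Big(\bigcap_{i\in[k]}A_i\Big)\cap I_2\Big)\ge\frac12-\sum_{i\in[k]}q_i-a-\varepsilon\ge\frac12-2a-2\varepsilon.$$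
   Context: For integers $m\le n$, $[m,n]=\{m,\ldots,n\}$ (empty if $m>n$), $[n]=[1,n]$, and $d(X)=|X|/n$ for $X\subseteq[n]$. A Schur triple in $X\subseteq\mathbb{Z}$ is a triple $\{x,y,z\}\subseteq X$ of not necessarily distinct elements with $x+y=z$; a set is sum-free if it contains no Schur triple, and a sum-free subset of $[n]$ is maximal if it is not properly contained in another sum-free subset of $[n]$. A sum-free set $X\subseteq[n]$ is of type (a) if $|X|\le 2n/5+1$; of type (b) if all its elements are odd; of type (c) if $|X|\le\min(X)$. -}

module Defs where

open import Data.Bool using (Bool; true; false; if_then_else_)
open import Data.Nat as ℕ using (ℕ; zero; suc; _≤_; _<_; _%_; ⌊_/2⌋; ⌈_/2⌉)
open import Data.Integer as ℤ using (ℤ; +_)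
open import Data.Fin using (Fin; toℕ)
open import Data.Fin.Subset using (Subset; _∈_; _∉_; _⊆_; ∣_∣; _∩_)
open import Data.Vec using (tabulate; lookup)
open import Data.List using (List; foldr; map; filter; allFin)
open import Data.Product using (Σ; _×_)
open import Data.Empty using (⊥)
open import Relation.Nullary.Decidable using (⌊_⌋)
open import Relation.Binary.PropositionalEquality using (_≡_)
open import Data.Rational as ℚ using (ℚ; 0ℚ; _+_)

-- A subset X of [n] = {1,…,n} is a `Subset n`; the index i : Fin n
-- stands for the integer suc (toℕ i).
val : {n : ℕ} → Fin n → ℕ
val i = suc (toℕ i)

_∈ℕ_ : {n : ℕ} → ℕ → Subset n → Set
m ∈ℕ X = Σ (Fin _) λ i → (val i ≡ m) × (i ∈ X)

SumFree : {n : ℕ} → Subset n → Set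
SumFree X = ∀ x y z → x ∈ℕ X → y ∈ℕ X → z ∈ℕ X → ℕ._+_ x y ≡ z → ⊥

MaximalSumFree : {n : ℕ} → Subset n → Set
MaximalSumFree {n} X = SumFree X × (∀ (Y : Subset n) → SumFree Y → X ⊆ Y → Y ⊆ X)

-- (p : ℤ) / n as a rational, for n ≥ 1 (value 0 for n = 0, never used)
divN : ℤ → ℕ → ℚ
divN p zero = 0ℚ
divN p (suc m) = p ℚ./ suc m

d : {n : ℕ} → Subset n → ℚ
d {n} X = divN (+ ∣ X ∣) n

TypeA : {n : ℕ} → Subset n → Set
TypeA {n} X = (+ ∣ X ∣ ℚ./ 1) ℚ.≤ ((+ (2 ℕ.* n) ℚ./ 5) + ℚ.1ℚ)

TypeB : {n : ℕ} → Subset n → Set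
TypeB X = ∀ m → m ∈ℕ X → m % 2 ≡ 1

TypeC : {n : ℕ} → Subset n → Set
TypeC X = ∀ m → m ∈ℕ X → ∣ X ∣ ≤ m

interval : (n : ℕ) → ℤ → ℤ → Subset n
interval n lo hi = tabulate λ i → ⌊ lo ℤ.≤? (+ val i) ⌋ Data.Bool.∧ ⌊ (+ val i) ℤ.≤? hi ⌋
  where import Data.Bool

-- indices of [r] \ C, and of [k] (as elements of Fin r: i ↦ toℕ i + 1)
notIn : {r : ℕ} → Subset r → List (Fin r)
notIn {r} C = filter (λ i → ¬? (i ∈? C)) (allFin r)
  where open import Data.Fin.Subset.Properties using (_∈?_)
        open import Relation.Nullary.Decidable using (¬?)

firstK : (r k : ℕ) → List (Fin r)
firstK r k = filter (λ i → toℕ i ℕ.<? k) (allFin r)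

sumℤ : {r : ℕ} → List (Fin r) → (Fin r → ℤ) → ℤ
sumℤ is f = foldr ℤ._+_ (+ 0) (map f is)

sumℚ : {r : ℕ} → List (Fin r) → (Fin r → ℚ) → ℚ
sumℚ is f = foldr _+_ 0ℚ (map f is)

aN : {n r : ℕ} → (Fin r → Subset n) → Subset r → ℤ
aN {n} A C = sumℤ (notIn C) λ i → (+ ⌈ n /2⌉) ℤ.- (+ ∣ A i ∣)

interK : {n r : ℕ} → ℕ → (Fin r → Subset n) → Subset n
interK {n} {r} k A = Data.Fin.Subset.⋂ (map A (firstK r k))
  where import Data.Fin.Subset

module Submission where

-- Write h = ⌊n/2⌋, c = ⌈n/2⌉ and an = Σ_{i∉C} (c − |Aᵢ|); every term is nonnegative since
-- sets of type (b) or (c) have at most c elements. A set A of type (c) lies in [|A|, n], so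
-- A ∩ J₃ ⊆ [|A|, h] has at most (c − |A|) + 1 elements, and summing over i ∈ [k] gives
-- n·Σ qᵢ ≤ an + r. As moreover c − |A| ≤ an, the elements of A below I₂ but outside J₃ lie in
-- [|A|, h − an], which has at most one point; hence |I₂ ∖ A| ≤ |A ∩ J₃| + (c − |A|) + 1.
-- Since |I₂| = c, the Aᵢ with i ∈ [k] share at least c − Σᵢ |I₂ ∖ Aᵢ| ≥ n/2 − n(Σ qᵢ + a) − r
-- elements of I₂, and r/n ≤ ε once n is large.

open import Defs

module Sums where

  open import Data.Nat using (ℕ; suc; _+_; _≤_; z≤n)
  open import Data.Nat.Properties
  open import Algebra.Properties.CommutativeSemigroup +-commutativeSemigroup using (interchange)
  open import Data.Integer as ℤ using ()
  open import Data.Fin using (Fin)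
  open import Data.List using (List; []; _∷_; map; foldr; length)
  import Data.List.Membership.Propositional as List
  open import Data.List.Relation.Unary.All using (All; []; _∷_)
  open import Data.List.Relation.Unary.Any using (here; there)
  open import Data.List.Relation.Binary.Sublist.Propositional using ([]; _∷_; _∷ʳ_) renaming (_⊆_ to _⊑_)
  open import Relation.Binary.PropositionalEquality

  sumℕ : ∀ {I : Set} → List I → (I → ℕ) → ℕ
  sumℕ is f = foldr _+_ 0 (map f is)

  module _ {I : Set} where

    sumℕ-+ : ∀ (is : List I) f g → sumℕ is (λ i → f i + g i) ≡ sumℕ is f + sumℕ is g
    sumℕ-+ []       f g = refl
    sumℕ-+ (i ∷ is) f g = begin
      (f i + g i) + sumℕ is (λ i → f i + g i)  ≡⟨ cong (λ m → (f i + g i) + m) (sumℕ-+ is f g) ⟩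
      (f i + g i) + (sumℕ is f + sumℕ is g)    ≡⟨ interchange (f i) (g i) (sumℕ is f) (sumℕ is g) ⟩
      (f i + sumℕ is f) + (g i + sumℕ is g)    ∎
      where open ≡-Reasoning

    sumℕ-suc : ∀ (is : List I) f → sumℕ is (λ i → suc (f i)) ≡ sumℕ is f + length is
    sumℕ-suc []       f = refl
    sumℕ-suc (i ∷ is) f = begin
      suc (f i + sumℕ is (λ i → suc (f i)))  ≡⟨ cong (λ m → suc (f i + m)) (sumℕ-suc is f) ⟩
      suc (f i + (sumℕ is f + length is))    ≡⟨ cong suc (+-assoc (f i) (sumℕ is f) (length is)) ⟨
      suc ((f i + sumℕ is f) + length is)    ≡⟨ +-suc (f i + sumℕ is f) (length is) ⟨
      (f i + sumℕ is f) + suc (length is)    ∎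
      where open ≡-Reasoning

    sumℕ-mono-≤ : ∀ {is : List I} {f g} → All (λ i → f i ≤ g i) is → sumℕ is f ≤ sumℕ is g
    sumℕ-mono-≤ []           = z≤n
    sumℕ-mono-≤ (fi≤gi ∷ le) = +-mono-≤ fi≤gi (sumℕ-mono-≤ le)

    sumℕ-mono-⊑ : ∀ {is js : List I} f → is ⊑ js → sumℕ is f ≤ sumℕ js f
    sumℕ-mono-⊑ f []            = z≤n
    sumℕ-mono-⊑ f (j ∷ʳ is⊑js)   = ≤-trans (sumℕ-mono-⊑ f is⊑js) (m≤n+m _ (f j))
    sumℕ-mono-⊑ f (refl ∷ is⊑js) = +-monoʳ-≤ _ (sumℕ-mono-⊑ f is⊑js)

    ∈⇒≤sumℕ : ∀ {is : List I} {i} f → i List.∈ is → f i ≤ sumℕ is f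
    ∈⇒≤sumℕ f (here refl) = m≤m+n _ _
    ∈⇒≤sumℕ f (there i∈is) = ≤-trans (∈⇒≤sumℕ f i∈is) (m≤n+m _ _)

  sumℤ≡+sumℕ : ∀ {r} {is : List (Fin r)} {g f} → All (λ i → g i ≡ ℤ.+ f i) is → sumℤ is g ≡ ℤ.+ sumℕ is f
  sumℤ≡+sumℕ []            = refl
  sumℤ≡+sumℕ (gi≡fi ∷ eqs) = cong₂ ℤ._+_ gi≡fi (sumℤ≡+sumℕ eqs)


module Counting where

  open import Data.Nat using (ℕ; zero; suc; pred; _+_; _∸_; _%_; _≤_; _<_; z≤n; s≤s; s≤s⁻¹; ⌊_/2⌋; ⌈_/2⌉)
  open import Data.Nat.Properties
  open import Algebra.Properties.CommutativeSemigroup +-commutativeSemigroup using (x∙yz≈z∙yx)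
  open import Data.Fin using (Fin; toℕ)
  open import Data.Fin.Properties using (toℕ<n)
  open import Data.Fin.Subset using (Subset; inside; outside; _∈_; _∉_; _⊆_; ∣_∣; _∩_; _─_; ⋂; ⊤; ⊥)
  open import Data.Fin.Subset.Properties
    using (Empty-unique; ∣⊥∣≡0; ∣p∣≤n; p⊆q⇒∣p∣≤∣q∣; ∩-assoc; ∩-comm; ∩-identityˡ; p∩q⊆q; x∈p∩q⁺; x∈p∩q⁻;
           p─q⊆p; x∈p∧x∉q⇒x∈p─q)
  open import Data.Vec using ([]; _∷_; here; there)
  open import Data.List using (List; []; _∷_; map)
  open import Data.Product using (_×_; _,_; proj₁; proj₂)
  import Data.Product as Prod
  open import Function using (_∘_; id)
  open import Relation.Binary.PropositionalEquality
  open Sums using (sumℕ)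

  ∣p∣≤b∸a : ∀ {n} a b (p : Subset n) → (∀ {j} → j ∈ p → a ≤ toℕ j × toℕ j < b) → ∣ p ∣ ≤ b ∸ a
  ∣p∣≤b∸a {n} a zero p bounds = begin
    ∣ p ∣  ≡⟨ cong ∣_∣ (Empty-unique λ (_ , j∈p) → n≮0 (proj₂ (bounds j∈p))) ⟩
    ∣ ⊥ {n} ∣  ≡⟨ ∣⊥∣≡0 n ⟩
    0      ≤⟨ z≤n ⟩
    0 ∸ a  ∎
    where open ≤-Reasoning
  ∣p∣≤b∸a a (suc b) [] bounds = z≤n
  ∣p∣≤b∸a zero (suc b) (inside ∷ p) bounds =
    s≤s (∣p∣≤b∸a 0 b p λ j∈p → z≤n , s≤s⁻¹ (proj₂ (bounds (there j∈p))))
  ∣p∣≤b∸a zero (suc b) (outside ∷ p) bounds =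
    m≤n⇒m≤1+n (∣p∣≤b∸a 0 b p λ j∈p → z≤n , s≤s⁻¹ (proj₂ (bounds (there j∈p))))
  ∣p∣≤b∸a (suc a) (suc b) (inside ∷ p) bounds with () ← proj₁ (bounds here)
  ∣p∣≤b∸a (suc a) (suc b) (outside ∷ p) bounds =
    ∣p∣≤b∸a a b p (Prod.map s≤s⁻¹ s≤s⁻¹ ∘ bounds ∘ there)

  ∣p∣≤1+b∸a : ∀ {n} a b (p : Subset n) → (∀ {j} → j ∈ p → a ≤ val j × val j ≤ b) → ∣ p ∣ ≤ suc b ∸ a
  ∣p∣≤1+b∸a a b p bounds =
    ≤-trans (∣p∣≤b∸a (pred a) b p (Prod.map pred-mono-≤ id ∘ bounds)) (b∸pred[a]≤1+b∸a a)
    where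
    b∸pred[a]≤1+b∸a : ∀ a → b ∸ pred a ≤ suc b ∸ a
    b∸pred[a]≤1+b∸a zero    = n≤1+n b
    b∸pred[a]≤1+b∸a (suc a) = ≤-refl

  ∣p∣≡∣p∩q∣+∣p─q∣ : ∀ {n} (p q : Subset n) → ∣ p ∣ ≡ ∣ p ∩ q ∣ + ∣ p ─ q ∣
  ∣p∣≡∣p∩q∣+∣p─q∣ [] [] = refl
  ∣p∣≡∣p∩q∣+∣p─q∣ (inside ∷ p) (inside ∷ q) = cong suc (∣p∣≡∣p∩q∣+∣p─q∣ p q)
  ∣p∣≡∣p∩q∣+∣p─q∣ (inside ∷ p) (outside ∷ q) =
    trans (cong suc (∣p∣≡∣p∩q∣+∣p─q∣ p q)) (sym (+-suc _ _))
  ∣p∣≡∣p∩q∣+∣p─q∣ (outside ∷ p) (inside ∷ q) = ∣p∣≡∣p∩q∣+∣p─q∣ p q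
  ∣p∣≡∣p∩q∣+∣p─q∣ (outside ∷ p) (outside ∷ q) = ∣p∣≡∣p∩q∣+∣p─q∣ p q

  ∣p─q∣+∣q∣≡∣q─p∣+∣p∣ : ∀ {n} (p q : Subset n) → ∣ p ─ q ∣ + ∣ q ∣ ≡ ∣ q ─ p ∣ + ∣ p ∣
  ∣p─q∣+∣q∣≡∣q─p∣+∣p∣ p q = begin
    ∣ p ─ q ∣ + ∣ q ∣                        ≡⟨ cong (λ m → ∣ p ─ q ∣ + m) (∣p∣≡∣p∩q∣+∣p─q∣ q p) ⟩
    ∣ p ─ q ∣ + (∣ q ∩ p ∣ + ∣ q ─ p ∣)      ≡⟨ cong (λ m → ∣ p ─ q ∣ + (m + ∣ q ─ p ∣)) (cong ∣_∣ (∩-comm q p)) ⟩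
    ∣ p ─ q ∣ + (∣ p ∩ q ∣ + ∣ q ─ p ∣)      ≡⟨ x∙yz≈z∙yx (∣ p ─ q ∣) (∣ p ∩ q ∣) (∣ q ─ p ∣) ⟩
    ∣ q ─ p ∣ + (∣ p ∩ q ∣ + ∣ p ─ q ∣)      ≡⟨ cong (λ m → ∣ q ─ p ∣ + m) (∣p∣≡∣p∩q∣+∣p─q∣ p q) ⟨
    ∣ q ─ p ∣ + ∣ p ∣                        ∎
    where open ≡-Reasoning

  x∈p─q⇒x∉q : ∀ {n} {x : Fin n} {p q : Subset n} → x ∈ p ─ q → x ∉ q
  x∈p─q⇒x∉q {p = _ ∷ p} {outside ∷ q} here        ()
  x∈p─q⇒x∉q {p = _ ∷ p} {_ ∷ q}       (there x∈p─q) (there x∈q) = x∈p─q⇒x∉q x∈p─q x∈q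

  ─-monoˡ-⊆ : ∀ {n} {p q : Subset n} (r : Subset n) → p ⊆ q → p ─ r ⊆ q ─ r
  ─-monoˡ-⊆ {p = p} r p⊆q x∈p─r = x∈p∧x∉q⇒x∈p─q (p⊆q (p─q⊆p p r x∈p─r)) (x∈p─q⇒x∉q x∈p─r)

  ∣p∣≤∣⋂∩p∣+Σ∣p─A∣ : ∀ {n} {I : Set} (A : I → Subset n) (is : List I) (p : Subset n) →
                      ∣ p ∣ ≤ ∣ ⋂ (map A is) ∩ p ∣ + sumℕ is (λ i → ∣ p ─ A i ∣)
  ∣p∣≤∣⋂∩p∣+Σ∣p─A∣ A [] p = ≤-reflexive (begin
    ∣ p ∣          ≡⟨ cong ∣_∣ (∩-identityˡ p) ⟨
    ∣ ⊤ ∩ p ∣      ≡⟨ +-identityʳ _ ⟨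
    ∣ ⊤ ∩ p ∣ + 0  ∎)
    where open ≡-Reasoning
  ∣p∣≤∣⋂∩p∣+Σ∣p─A∣ A (i ∷ is) p = begin
    ∣ p ∣                                           ≤⟨ ∣p∣≤∣⋂∩p∣+Σ∣p─A∣ A is p ⟩
    ∣ B ∩ p ∣ + S                                   ≡⟨ cong (_+ S) (∣p∣≡∣p∩q∣+∣p─q∣ (B ∩ p) (A i)) ⟩
    (∣ (B ∩ p) ∩ A i ∣ + ∣ (B ∩ p) ─ A i ∣) + S      ≤⟨ +-monoˡ-≤ S (+-monoʳ-≤ _ ∣B∩p─Ai∣≤∣p─Ai∣) ⟩
    (∣ (B ∩ p) ∩ A i ∣ + ∣ p ─ A i ∣) + S            ≡⟨ cong (λ q → ∣ q ∣ + ∣ p ─ A i ∣ + S) B∩p∩Ai≡Ai∩B∩p ⟩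
    (∣ (A i ∩ B) ∩ p ∣ + ∣ p ─ A i ∣) + S            ≡⟨ +-assoc (∣ (A i ∩ B) ∩ p ∣) (∣ p ─ A i ∣) S ⟩
    ∣ (A i ∩ B) ∩ p ∣ + (∣ p ─ A i ∣ + S)            ∎
    where
    open ≤-Reasoning
    B : Subset _
    B = ⋂ (map A is)
    S : ℕ
    S = sumℕ is (λ i → ∣ p ─ A i ∣)
    B∩p∩Ai≡Ai∩B∩p : (B ∩ p) ∩ A i ≡ (A i ∩ B) ∩ p
    B∩p∩Ai≡Ai∩B∩p = trans (∩-comm (B ∩ p) (A i)) (sym (∩-assoc (A i) B p))
    ∣B∩p─Ai∣≤∣p─Ai∣ : ∣ (B ∩ p) ─ A i ∣ ≤ ∣ p ─ A i ∣
    ∣B∩p─Ai∣≤∣p─Ai∣ = p⊆q⇒∣p∣≤∣q∣ (─-monoˡ-⊆ (A i) (p∩q⊆q B p))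

  m+m≤1+n⇒m≤⌈n/2⌉ : ∀ {m n} → m + m ≤ suc n → m ≤ ⌈ n /2⌉
  m+m≤1+n⇒m≤⌈n/2⌉ {m} {n} m+m≤1+n = begin
    m              ≡⟨ n≡⌊n+n/2⌋ m ⟩
    ⌊ m + m /2⌋    ≤⟨ ⌊n/2⌋-mono m+m≤1+n ⟩
    ⌊ suc n /2⌋    ∎
    where open ≤-Reasoning

  odd⇒∣p∣≤⌈n/2⌉ : ∀ {n} (p : Subset n) → (∀ {j} → j ∈ p → val j % 2 ≡ 1) → ∣ p ∣ ≤ ⌈ n /2⌉
  odd⇒∣p∣≤⌈n/2⌉ []                    odd = z≤n
  odd⇒∣p∣≤⌈n/2⌉ (x ∷ [])              odd = ∣p∣≤n (x ∷ [])
  odd⇒∣p∣≤⌈n/2⌉ (x ∷ inside ∷ p)      odd with () ← odd (there here)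
  odd⇒∣p∣≤⌈n/2⌉ (inside ∷ outside ∷ p)  odd = s≤s (odd⇒∣p∣≤⌈n/2⌉ p (odd ∘ there ∘ there))
  odd⇒∣p∣≤⌈n/2⌉ (outside ∷ outside ∷ p) odd = m≤n⇒m≤1+n (odd⇒∣p∣≤⌈n/2⌉ p (odd ∘ there ∘ there))

  TypeB⇒∣X∣≤⌈n/2⌉ : ∀ {n} {X : Subset n} → TypeB X → ∣ X ∣ ≤ ⌈ n /2⌉
  TypeB⇒∣X∣≤⌈n/2⌉ {X = X} tb = odd⇒∣p∣≤⌈n/2⌉ X λ j∈X → tb _ (_ , refl , j∈X)

  TypeC⇒∣X∣≤val : ∀ {n} {X : Subset n} {j} → TypeC X → j ∈ X → ∣ X ∣ ≤ val j
  TypeC⇒∣X∣≤val tc j∈X = tc _ (_ , refl , j∈X)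

  TypeC⇒∣X∣≤⌈n/2⌉ : ∀ {n} {X : Subset n} → TypeC X → ∣ X ∣ ≤ ⌈ n /2⌉
  TypeC⇒∣X∣≤⌈n/2⌉ {n} {X} tc = m+m≤1+n⇒m≤⌈n/2⌉ (m≤o∸n⇒m+n≤o _ ∣X∣≤1+n ∣X∣≤1+n∸∣X∣)
    where
    ∣X∣≤1+n : ∣ X ∣ ≤ suc n
    ∣X∣≤1+n = m≤n⇒m≤1+n (∣p∣≤n X)
    ∣X∣≤1+n∸∣X∣ : ∣ X ∣ ≤ suc n ∸ ∣ X ∣
    ∣X∣≤1+n∸∣X∣ = ∣p∣≤1+b∸a ∣ X ∣ n X λ {j} j∈X → TypeC⇒∣X∣≤val tc j∈X , toℕ<n j

  module _ {n} {A : Subset n} (tc : TypeC A) where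

    ∣A∩J∣+∣A∣≤1+h : ∀ {J h} → (∀ {j} → j ∈ J → val j ≤ h) → ∣ A ∣ ≤ suc h → ∣ A ∩ J ∣ + ∣ A ∣ ≤ suc h
    ∣A∩J∣+∣A∣≤1+h {J} {h} J≤h ∣A∣≤1+h = m≤o∸n⇒m+n≤o _ ∣A∣≤1+h (∣p∣≤1+b∸a ∣ A ∣ h (A ∩ J) bounds)
      where
      bounds : ∀ {j} → j ∈ A ∩ J → ∣ A ∣ ≤ val j × val j ≤ h
      bounds j∈A∩J = let j∈A , j∈J = x∈p∩q⁻ A J j∈A∩J in TypeC⇒∣X∣≤val tc j∈A , J≤h j∈J

    -- Elements of A outside I and J lie in [|A|, h − w], which has at most one point.
    ∣A─I∣≤1+∣A∩J∣ : ∀ {I J h w} → (∀ {j} → j ∉ I → val j ≤ h) → (∀ {j} → j ∉ J → val j ≤ h → val j + w ≤ h) →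
                    h ≤ ∣ A ∣ + w → ∣ A ─ I ∣ ≤ suc ∣ A ∩ J ∣
    ∣A─I∣≤1+∣A∩J∣ {I} {J} {h} {w} I∁≤h J∁≤h-w h≤∣A∣+w = begin
      ∣ A ─ I ∣                            ≡⟨ ∣p∣≡∣p∩q∣+∣p─q∣ (A ─ I) J ⟩
      ∣ (A ─ I) ∩ J ∣ + ∣ (A ─ I) ─ J ∣    ≤⟨ +-mono-≤ (p⊆q⇒∣p∣≤∣q∣ A─I∩J⊆A∩J) ∣A─I─J∣≤1 ⟩
      ∣ A ∩ J ∣ + 1                        ≡⟨ +-comm ∣ A ∩ J ∣ 1 ⟩
      suc ∣ A ∩ J ∣                        ∎
      where
      open ≤-Reasoning
      A─I∩J⊆A∩J : (A ─ I) ∩ J ⊆ A ∩ J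
      A─I∩J⊆A∩J j∈ = let j∈A─I , j∈J = x∈p∩q⁻ (A ─ I) J j∈ in x∈p∩q⁺ (p─q⊆p A I j∈A─I , j∈J)
      bounds : ∀ {j} → j ∈ (A ─ I) ─ J → ∣ A ∣ ≤ val j × val j ≤ h ∸ w
      bounds {j} j∈ = let j∈A─I = p─q⊆p (A ─ I) J j∈ in
        TypeC⇒∣X∣≤val tc (p─q⊆p A I j∈A─I) ,
        m+n≤o⇒m≤o∸n (val j) (J∁≤h-w (x∈p─q⇒x∉q j∈) (I∁≤h (x∈p─q⇒x∉q j∈A─I)))
      h∸w≤∣A∣ : h ∸ w ≤ ∣ A ∣
      h∸w≤∣A∣ = m≤n+o⇒m∸n≤o h w (subst (h ≤_) (+-comm ∣ A ∣ w) h≤∣A∣+w)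
      ∣A─I─J∣≤1 : ∣ (A ─ I) ─ J ∣ ≤ 1
      ∣A─I─J∣≤1 = ≤-trans (∣p∣≤1+b∸a ∣ A ∣ (h ∸ w) ((A ─ I) ─ J) bounds)
        (m≤n+o⇒m∸n≤o (suc (h ∸ w)) ∣ A ∣ (subst (suc (h ∸ w) ≤_) (+-comm 1 ∣ A ∣) (s≤s h∸w≤∣A∣)))


module Intervals where

  open import Data.Bool.Properties using (T-≡; T-∧)
  open import Data.Nat using (ℕ; _+_; _∸_; _≤_; _<_; z≤n; s≤s⁻¹; ⌊_/2⌋; ⌈_/2⌉)
  open import Data.Nat.Properties
  open import Data.Integer as ℤ using (ℤ; +_; +≤+; _⊖_)
  open import Data.Integer.Properties using (drop‿+≤+; [+m]-[+n]≡m⊖n; distribˡ-⊖-+-pos; ⊖-monoˡ-≤; ⊖-≥)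
  import Data.Integer.Properties as ℤ
  open import Data.Fin using (Fin)
  open import Data.Fin.Properties using (toℕ<n)
  open import Data.Fin.Subset using (Subset; _∈_; _∉_; ∣_∣; ∁)
  open import Data.Fin.Subset.Properties using (∣∁p∣≡n∸∣p∣; x∈∁p⇒x∉p)
  open import Data.Vec.Properties using (lookup∘tabulate; []=⇒lookup; lookup⇒[]=)
  open import Data.Product using (_×_; _,_; proj₁; proj₂)
  import Data.Product as Prod
  open import Data.Empty using (⊥-elim)
  open import Function using (Equivalence)
  open import Relation.Nullary using (Dec; yes; no)
  open import Relation.Nullary.Decidable using (⌊_⌋; toWitness; fromWitness)
  open import Relation.Binary.PropositionalEquality
  open Counting using (∣p∣≤b∸a)

  module _ {n : ℕ} {lo hi : ℤ} {j : Fin n} where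

    private
      lo≤j? : Dec (lo ℤ.≤ + val j)
      lo≤j? = lo ℤ.≤? + val j
      j≤hi? : Dec (+ val j ℤ.≤ hi)
      j≤hi? = + val j ℤ.≤? hi

    ∈-interval⁻ : j ∈ interval n lo hi → lo ℤ.≤ + val j × + val j ℤ.≤ hi
    ∈-interval⁻ j∈ = Prod.map (toWitness {a? = lo≤j?}) (toWitness {a? = j≤hi?})
      (Equivalence.to T-∧ (Equivalence.from T-≡ (trans (sym (lookup∘tabulate _ j)) ([]=⇒lookup j∈))))

    ∈-interval⁺ : lo ℤ.≤ + val j → + val j ℤ.≤ hi → j ∈ interval n lo hi
    ∈-interval⁺ lo≤j j≤hi = lookup⇒[]= j _ (trans (lookup∘tabulate _ j)
      (Equivalence.to T-≡ (Equivalence.from (T-∧ {⌊ lo≤j? ⌋} {⌊ j≤hi? ⌋}) (fromWitness lo≤j , fromWitness j≤hi))))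

  I₂ : (n : ℕ) → Subset n
  I₂ n = interval n (+ ⌊ n /2⌋ ℤ.+ + 1) (+ n)

  J₃ : (n : ℕ) → ℤ → Subset n
  J₃ n σ = interval n ((+ ⌊ n /2⌋ ℤ.- σ) ℤ.+ + 1) (+ ⌊ n /2⌋)

  module _ {n : ℕ} {j : Fin n} where

    ∈I₂⇒⌊n/2⌋<val : j ∈ I₂ n → ⌊ n /2⌋ < val j
    ∈I₂⇒⌊n/2⌋<val j∈I₂ = subst (_≤ val j) (+-comm ⌊ n /2⌋ 1) (drop‿+≤+ (proj₁ (∈-interval⁻ j∈I₂)))

    ∉I₂⇒val≤⌊n/2⌋ : j ∉ I₂ n → val j ≤ ⌊ n /2⌋
    ∉I₂⇒val≤⌊n/2⌋ j∉I₂ with val j ≤? ⌊ n /2⌋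
    ... | yes j≤h = j≤h
    ... | no  j≰h = ⊥-elim (j∉I₂ (∈-interval⁺ (+≤+ (subst (_≤ val j) (+-comm 1 ⌊ n /2⌋) (≰⇒> j≰h)))
                                               (+≤+ (toℕ<n j))))

    ∈J₃⇒val≤⌊n/2⌋ : ∀ {σ} → j ∈ J₃ n σ → val j ≤ ⌊ n /2⌋
    ∈J₃⇒val≤⌊n/2⌋ j∈J₃ = drop‿+≤+ (proj₂ (∈-interval⁻ j∈J₃))

    ∉J₃⇒val+w≤⌊n/2⌋ : ∀ {w} → j ∉ J₃ n (+ w) → val j ≤ ⌊ n /2⌋ → val j + w ≤ ⌊ n /2⌋
    ∉J₃⇒val+w≤⌊n/2⌋ {w} j∉J₃ j≤h with val j + w ≤? ⌊ n /2⌋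
    ... | yes j+w≤h = j+w≤h
    ... | no  j+w≰h = ⊥-elim (j∉J₃ (∈-interval⁺ (lower (≰⇒> j+w≰h)) (+≤+ j≤h)))
      where
      h : ℕ
      h = ⌊ n /2⌋
      lower : h < val j + w → (+ h ℤ.- + w) ℤ.+ + 1 ℤ.≤ + val j
      lower h<j+w = begin
        (+ h ℤ.- + w) ℤ.+ + 1  ≡⟨ cong (ℤ._+ + 1) ([+m]-[+n]≡m⊖n h w) ⟩
        (h ⊖ w) ℤ.+ + 1        ≡⟨ distribˡ-⊖-+-pos 1 h w ⟩
        (h + 1) ⊖ w            ≤⟨ ⊖-monoˡ-≤ w (subst (_≤ val j + w) (+-comm 1 h) h<j+w) ⟩
        (val j + w) ⊖ w        ≡⟨ ⊖-≥ (m≤n+m w (val j)) ⟩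
        + (val j + w ∸ w)      ≡⟨ cong +_ (m+n∸n≡m (val j) w) ⟩
        + val j                ∎
        where open ℤ.≤-Reasoning

  n∸⌊n/2⌋≡⌈n/2⌉ : ∀ n → n ∸ ⌊ n /2⌋ ≡ ⌈ n /2⌉
  n∸⌊n/2⌋≡⌈n/2⌉ n = trans (cong (_∸ ⌊ n /2⌋) (sym (⌊n/2⌋+⌈n/2⌉≡n n))) (m+n∸m≡n ⌊ n /2⌋ ⌈ n /2⌉)

  ∣I₂∣≡⌈n/2⌉ : ∀ n → ∣ I₂ n ∣ ≡ ⌈ n /2⌉
  ∣I₂∣≡⌈n/2⌉ n = ≤-antisym ∣I₂∣≤⌈n/2⌉ ⌈n/2⌉≤∣I₂∣
    where
    h : ℕ
    h = ⌊ n /2⌋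
    ∣I₂∣≤⌈n/2⌉ : ∣ I₂ n ∣ ≤ ⌈ n /2⌉
    ∣I₂∣≤⌈n/2⌉ = subst (∣ I₂ n ∣ ≤_) (n∸⌊n/2⌋≡⌈n/2⌉ n)
      (∣p∣≤b∸a h n (I₂ n) λ {j} j∈I₂ → s≤s⁻¹ (∈I₂⇒⌊n/2⌋<val j∈I₂) , toℕ<n j)
    ∣∁I₂∣≤⌊n/2⌋ : ∣ ∁ (I₂ n) ∣ ≤ h
    ∣∁I₂∣≤⌊n/2⌋ = ∣p∣≤b∸a 0 h (∁ (I₂ n)) λ j∈∁I₂ → z≤n , ∉I₂⇒val≤⌊n/2⌋ (x∈∁p⇒x∉p j∈∁I₂)
    ⌈n/2⌉≤∣I₂∣ : ⌈ n /2⌉ ≤ ∣ I₂ n ∣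
    ⌈n/2⌉≤∣I₂∣ = subst (_≤ ∣ I₂ n ∣) (n∸⌊n/2⌋≡⌈n/2⌉ n) (m≤n+o⇒m∸n≤o n h (begin
      n                          ≤⟨ m≤n+m∸n n ∣ I₂ n ∣ ⟩
      ∣ I₂ n ∣ + (n ∸ ∣ I₂ n ∣)   ≡⟨ cong (λ m → ∣ I₂ n ∣ + m) (∣∁p∣≡n∸∣p∣ (I₂ n)) ⟨
      ∣ I₂ n ∣ + ∣ ∁ (I₂ n) ∣     ≤⟨ +-monoʳ-≤ ∣ I₂ n ∣ ∣∁I₂∣≤⌊n/2⌋ ⟩
      ∣ I₂ n ∣ + h               ≡⟨ +-comm ∣ I₂ n ∣ h ⟩
      h + ∣ I₂ n ∣               ∎))
      where open ≤-Reasoning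

module Estimates where

  open import Data.Nat using (ℕ; suc; _+_; _∸_; _≤_; _<_; _<?_; ⌊_/2⌋; ⌈_/2⌉)
  open import Data.Nat.Properties
  open import Data.Integer as ℤ using ()
  open import Data.Integer.Properties using ([+m]-[+n]≡m⊖n; ⊖-≥)
  open import Data.Fin using (Fin; toℕ)
  open import Data.Fin.Subset using (Subset; _∈_; _∉_; ∣_∣; _∩_; _─_)
  open import Data.Fin.Subset.Properties using (_∈?_)
  open import Data.List using (List; length; allFin)
  open import Data.List.Properties using (length-filter; length-tabulate)
  open import Data.List.Membership.Propositional.Properties using (∈-filter⁺; ∈-allFin)
  open import Data.List.Relation.Unary.All as All using (All)
  open import Data.List.Relation.Unary.All.Properties using (all-filter)
  open import Data.List.Relation.Binary.Sublist.Propositional using (⊆-refl) renaming (_⊆_ to _⊑_)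
  open import Data.List.Relation.Binary.Sublist.Propositional.Properties using (filter⁺)
  open import Data.Sum using (_⊎_; [_,_])
  open import Relation.Nullary.Decidable using (¬?)
  open import Relation.Binary.PropositionalEquality hiding (J)
  open Sums
  open Counting
  open Intervals

  module Bounds {n r : ℕ} (A : Fin r → Subset n) (C : Subset r)
    (B⊎C : ∀ i → i ∉ C → TypeB (A i) ⊎ TypeC (A i)) (k : ℕ)
    (C-first : ∀ i → toℕ i < k → TypeC (A i)) (∉C-first : ∀ i → toℕ i < k → i ∉ C) where

    -- In the notation of the statement, an = a·n, qn = n·Σ qᵢ and common = n·d((⋂ Aᵢ) ∩ I₂).
    deficit : Fin r → ℕ
    deficit i = ⌈ n /2⌉ ∸ ∣ A i ∣

    an : ℕ
    an = sumℕ (notIn C) deficit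

    J : Subset n
    J = J₃ n (aN A C)

    qn : ℕ
    qn = sumℕ (firstK r k) (λ i → ∣ A i ∩ J ∣)

    common : ℕ
    common = ∣ interK k A ∩ I₂ n ∣

    ∣A∣≤⌈n/2⌉ : ∀ {i} → i ∉ C → ∣ A i ∣ ≤ ⌈ n /2⌉
    ∣A∣≤⌈n/2⌉ {i} i∉C = [ TypeB⇒∣X∣≤⌈n/2⌉ , TypeC⇒∣X∣≤⌈n/2⌉ ] (B⊎C i i∉C)

    aN≡an : aN A C ≡ ℤ.+ an
    aN≡an = sumℤ≡+sumℕ (All.map deficit≡ (all-filter (λ i → ¬? (i ∈? C)) (allFin r)))
      where
      deficit≡ : ∀ {i} → i ∉ C → ℤ.+ ⌈ n /2⌉ ℤ.- ℤ.+ ∣ A i ∣ ≡ ℤ.+ deficit i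
      deficit≡ {i} i∉C = trans ([+m]-[+n]≡m⊖n ⌈ n /2⌉ ∣ A i ∣) (⊖-≥ (∣A∣≤⌈n/2⌉ i∉C))

    deficit≤an : ∀ {i} → i ∉ C → deficit i ≤ an
    deficit≤an {i} i∉C = ∈⇒≤sumℕ deficit (∈-filter⁺ (λ i → ¬? (i ∈? C)) (∈-allFin i) i∉C)

    Σdeficit≤an : sumℕ (firstK r k) deficit ≤ an
    Σdeficit≤an = sumℕ-mono-⊑ deficit
      (filter⁺ (λ i → toℕ i <? k) (λ i → ¬? (i ∈? C)) (λ { {i} refl → ∉C-first i }) (⊆-refl {x = allFin r}))

    length-firstK : length (firstK r k) ≤ r
    length-firstK = ≤-trans (length-filter (λ i → toℕ i <? k) (allFin r)) (≤-reflexive (length-tabulate _))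

    firstK<k : All (λ i → toℕ i < k) (firstK r k)
    firstK<k = all-filter (λ i → toℕ i <? k) (allFin r)

    module _ {i : Fin r} (i-first : toℕ i < k) where

      private
        α c : ℕ
        α = ∣ A i ∣
        c = ⌈ n /2⌉
        α≤c : α ≤ c
        α≤c = ∣A∣≤⌈n/2⌉ (∉C-first i i-first)

      ∣A∩J∣≤1+deficit : ∣ A i ∩ J ∣ ≤ suc (deficit i)
      ∣A∩J∣≤1+deficit = begin
        ∣ A i ∩ J ∣   ≤⟨ m+n≤o⇒m≤o∸n _ (∣A∩J∣+∣A∣≤1+h (C-first i i-first) J≤c (m≤n⇒m≤1+n α≤c)) ⟩
        suc c ∸ α     ≡⟨ +-∸-assoc 1 α≤c ⟩
        suc (c ∸ α)   ∎
        where
        open ≤-Reasoning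
        J≤c : ∀ {j} → j ∈ J → val j ≤ c
        J≤c j∈J = ≤-trans (∈J₃⇒val≤⌊n/2⌋ {σ = aN A C} j∈J) (⌊n/2⌋≤⌈n/2⌉ n)

      ∣I₂─A∣≤1+∣A∩J∣+deficit : ∣ I₂ n ─ A i ∣ ≤ suc (∣ A i ∩ J ∣ + deficit i)
      ∣I₂─A∣≤1+∣A∩J∣+deficit = begin
        ∣ I₂ n ─ A i ∣                       ≡⟨ m+n∸n≡m _ α ⟨
        ∣ I₂ n ─ A i ∣ + α ∸ α               ≡⟨ cong (_∸ α) (∣p─q∣+∣q∣≡∣q─p∣+∣p∣ (I₂ n) (A i)) ⟩
        ∣ A i ─ I₂ n ∣ + ∣ I₂ n ∣ ∸ α         ≤⟨ ∸-monoˡ-≤ α (+-mono-≤ ∣A─I₂∣≤1+∣A∩J∣ (≤-reflexive (∣I₂∣≡⌈n/2⌉ n))) ⟩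
        suc ∣ A i ∩ J ∣ + c ∸ α              ≡⟨ +-∸-assoc (suc ∣ A i ∩ J ∣) α≤c ⟩
        suc (∣ A i ∩ J ∣ + deficit i)        ∎
        where
        open ≤-Reasoning
        J∁≤h-an : ∀ {j} → j ∉ J → val j ≤ ⌊ n /2⌋ → val j + an ≤ ⌊ n /2⌋
        J∁≤h-an {j} j∉J = ∉J₃⇒val+w≤⌊n/2⌋ (subst (λ σ → j ∉ J₃ n σ) aN≡an j∉J)
        h≤α+an : ⌊ n /2⌋ ≤ α + an
        h≤α+an = begin
          ⌊ n /2⌋          ≤⟨ ⌊n/2⌋≤⌈n/2⌉ n ⟩
          c                ≤⟨ m≤n+m∸n c α ⟩
          α + deficit i    ≤⟨ +-monoʳ-≤ α (deficit≤an (∉C-first i i-first)) ⟩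
          α + an           ∎
        ∣A─I₂∣≤1+∣A∩J∣ : ∣ A i ─ I₂ n ∣ ≤ suc ∣ A i ∩ J ∣
        ∣A─I₂∣≤1+∣A∩J∣ = ∣A─I∣≤1+∣A∩J∣ (C-first i i-first) ∉I₂⇒val≤⌊n/2⌋ J∁≤h-an h≤α+an

    qn≤an+r : qn ≤ an + r
    qn≤an+r = begin
      qn                                              ≤⟨ sumℕ-mono-≤ (All.map ∣A∩J∣≤1+deficit firstK<k) ⟩
      sumℕ (firstK r k) (λ i → suc (deficit i))       ≡⟨ sumℕ-suc (firstK r k) deficit ⟩
      sumℕ (firstK r k) deficit + length (firstK r k)  ≤⟨ +-mono-≤ Σdeficit≤an length-firstK ⟩
      an + r                                          ∎
      where open ≤-Reasoning

    ⌈n/2⌉≤common+qn+an+r : ⌈ n /2⌉ ≤ common + ((qn + an) + r)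
    ⌈n/2⌉≤common+qn+an+r = begin
      ⌈ n /2⌉                                       ≡⟨ ∣I₂∣≡⌈n/2⌉ n ⟨
      ∣ I₂ n ∣                                      ≤⟨ ∣p∣≤∣⋂∩p∣+Σ∣p─A∣ A K (I₂ n) ⟩
      common + sumℕ K (λ i → ∣ I₂ n ─ A i ∣)         ≤⟨ +-monoʳ-≤ common (sumℕ-mono-≤ (All.map ∣I₂─A∣≤1+∣A∩J∣+deficit firstK<k)) ⟩
      common + sumℕ K (λ i → suc (∣ A i ∩ J ∣ + deficit i))
        ≡⟨ cong (common +_) (trans (sumℕ-suc K _) (cong (_+ length K) (sumℕ-+ K _ deficit))) ⟩
      common + ((qn + sumℕ K deficit) + length K)   ≤⟨ +-monoʳ-≤ common (+-mono-≤ (+-monoʳ-≤ qn Σdeficit≤an) length-firstK) ⟩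
      common + ((qn + an) + r)                      ∎
      where
      open ≤-Reasoning
      K : List (Fin r)
      K = firstK r k

module Densities where

  open import Data.Nat as ℕ using (ℕ; suc; ⌊_/2⌋; ⌈_/2⌉)
  open import Data.Nat.Properties as ℕ using (⌊n/2⌋+⌈n/2⌉≡n; ⌊n/2⌋≤⌈n/2⌉; *-identityˡ; *-comm)
  open import Data.Integer as ℤ using (+_; +≤+; +<+; -[1+_])
  open import Data.Integer.Properties using (pos-*)
  open import Data.Integer.Solver using (module +-*-Solver)
  open import Data.Rational using (ℚ; mkℚ; 0ℚ; ½; _+_; _-_; _*_; -_; _/_; _≤_; _<_; *<*; toℚᵘ)
  open import Data.Rational.Properties
    using (toℚᵘ-fromℚᵘ; toℚᵘ-cancel-≤; toℚᵘ-homo-+; toℚᵘ-injective; ↥p/↧p≡p;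
           +-monoˡ-≤; +-monoʳ-≤; ≤-trans; ≤-reflexive; neg-antimono-≤; 0/n≡0; module ≤-Reasoning)
  import Data.Rational.Unnormalised as ℚᵘ
  import Data.Rational.Unnormalised.Properties as ℚᵘ
  open import Data.Rational.Solver as ℚ-Solver using ()
  open import Data.Fin using (Fin)
  open import Data.List using (List; []; _∷_)
  open import Data.Product using (Σ; _×_; _,_)
  open import Relation.Binary.PropositionalEquality
  open Sums using (sumℕ)

  private
    toℚᵘ-divN : ∀ x m → toℚᵘ (divN (+ x) (suc m)) ℚᵘ.≃ ℚᵘ.mkℚᵘ (+ x) m
    toℚᵘ-divN x m = toℚᵘ-fromℚᵘ (ℚᵘ.mkℚᵘ (+ x) m)

  divN-≤ : ∀ x y m m′ → x ℕ.* suc m′ ℕ.≤ y ℕ.* suc m → divN (+ x) (suc m) ≤ divN (+ y) (suc m′)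
  divN-≤ x y m m′ x*m′≤y*m = toℚᵘ-cancel-≤
    (ℚᵘ.≤-respˡ-≃ (ℚᵘ.≃-sym (toℚᵘ-divN x m)) (ℚᵘ.≤-respʳ-≃ (ℚᵘ.≃-sym (toℚᵘ-divN y m′))
      (ℚᵘ.*≤* (subst₂ ℤ._≤_ (pos-* x (suc m′)) (pos-* y (suc m)) (+≤+ x*m′≤y*m)))))

  divN-homo-+ : ∀ x y m → divN (+ x) (suc m) + divN (+ y) (suc m) ≡ divN (+ (x ℕ.+ y)) (suc m)
  divN-homo-+ x y m = toℚᵘ-injective (ℚᵘ.≃-trans (toℚᵘ-homo-+ (divN (+ x) (suc m)) (divN (+ y) (suc m)))
    (ℚᵘ.≃-trans (ℚᵘ.+-cong (toℚᵘ-divN x m) (toℚᵘ-divN y m))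
    (ℚᵘ.≃-trans (ℚᵘ.*≡* cross) (ℚᵘ.≃-sym (toℚᵘ-divN (x ℕ.+ y) m)))))
    where
    open +-*-Solver
    cross : (+ x ℤ.* + suc m ℤ.+ + y ℤ.* + suc m) ℤ.* + suc m ≡ (+ x ℤ.+ + y) ℤ.* (+ suc m ℤ.* + suc m)
    cross = solve 3 (λ x y n → (x :* n :+ y :* n) :* n := (x :+ y) :* (n :* n)) refl (+ x) (+ y) (+ suc m)

  sumℚ-divN : ∀ {r} (is : List (Fin r)) f m → sumℚ is (λ i → divN (+ f i) (suc m)) ≡ divN (+ sumℕ is f) (suc m)
  sumℚ-divN []       f m = sym (0/n≡0 (suc m))
  sumℚ-divN (i ∷ is) f m =
    trans (cong (λ q → divN (+ f i) (suc m) + q) (sumℚ-divN is f m)) (divN-homo-+ (f i) (sumℕ is f) m)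

  ½≤divN : ∀ {y m} → ⌈ suc m /2⌉ ℕ.≤ y → ½ ≤ divN (+ y) (suc m)
  ½≤divN {y} {m} ⌈n/2⌉≤y = divN-≤ 1 y 1 m (begin
    1 ℕ.* suc m                   ≡⟨ *-identityˡ (suc m) ⟩
    suc m                         ≡⟨ ⌊n/2⌋+⌈n/2⌉≡n (suc m) ⟨
    ⌊ suc m /2⌋ ℕ.+ ⌈ suc m /2⌉   ≤⟨ ℕ.+-mono-≤ (ℕ.≤-trans (⌊n/2⌋≤⌈n/2⌉ (suc m)) ⌈n/2⌉≤y) ⌈n/2⌉≤y ⟩
    y ℕ.+ y                       ≡⟨ cong (y ℕ.+_) (ℕ.+-identityʳ y) ⟨
    2 ℕ.* y                       ≡⟨ *-comm 2 y ⟩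
    y ℕ.* 2                       ∎)
    where open ℕ.≤-Reasoning

  positive⇒divN : ∀ {ε} → 0ℚ < ε → Σ ℕ λ p → Σ ℕ λ q → ε ≡ divN (+ suc p) (suc q)
  positive⇒divN {ε@(mkℚ (+ suc p) q _)} _ = p , q , sym (↥p/↧p≡p ε)
  positive⇒divN {mkℚ (+ 0) _ _} (*<* (+<+ ()))
  positive⇒divN {mkℚ -[1+ _ ] _ _} (*<* ())

  h≤d+[q+a+e]⇒h-q-a-e≤d : ∀ {h d q a e} → h ≤ d + ((q + a) + e) → ((h - q) - a) - e ≤ d
  h≤d+[q+a+e]⇒h-q-a-e≤d {h} {d} {q} {a} {e} h≤ = ≤-trans (+-monoˡ-≤ (- e) (+-monoˡ-≤ (- a) (+-monoˡ-≤ (- q) h≤)))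
    (≤-reflexive (solve 4 (λ d q a e → (((d :+ ((q :+ a) :+ e)) :- q) :- a) :- e := d) refl d q a e))
    where open ℚ-Solver.+-*-Solver

  q≤a+e⇒h-2a-2e≤h-q-a-e : ∀ {h q a e} → q ≤ a + e → (h - (+ 2 / 1) * a) - (+ 2 / 1) * e ≤ ((h - q) - a) - e
  q≤a+e⇒h-2a-2e≤h-q-a-e {h} {q} {a} {e} q≤a+e = ≤-trans
    (≤-reflexive (solve 3 (λ h a e → (h :- con (+ 2 / 1) :* a) :- con (+ 2 / 1) :* e := ((h :+ :- (a :+ e)) :- a) :- e)
                   refl h a e))
    (+-monoˡ-≤ (- e) (+-monoˡ-≤ (- a) (+-monoʳ-≤ h (neg-antimono-≤ q≤a+e))))
    where open ℚ-Solver.+-*-Solver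

  density-bounds : ∀ {m x s D r} {Q a ε : ℚ} → Q ≡ divN (+ x) (suc m) → a ≡ divN (+ s) (suc m) →
    x ℕ.≤ s ℕ.+ r → ⌈ suc m /2⌉ ℕ.≤ D ℕ.+ ((x ℕ.+ s) ℕ.+ r) → divN (+ r) (suc m) ≤ ε →
    (Q ≤ a + ε) × ((((½ - Q) - a) - ε) ≤ divN (+ D) (suc m))
                × (((½ - (+ 2 / 1) * a) - (+ 2 / 1) * ε) ≤ (((½ - Q) - a) - ε))
  density-bounds {m} {x} {s} {D} {r} {Q} {a} {ε} refl refl x≤s+r ⌈n/2⌉≤ R≤ε =
    Q≤a+ε , h≤d+[q+a+e]⇒h-q-a-e≤d {q = Q} {a} {ε} ½≤D+Q+a+ε , q≤a+e⇒h-2a-2e≤h-q-a-e {½} Q≤a+ε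
    where
    open ≤-Reasoning
    R : ℚ
    R = divN (+ r) (suc m)
    Q≤a+ε : Q ≤ a + ε
    Q≤a+ε = begin
      Q                         ≤⟨ divN-≤ x (s ℕ.+ r) m m (ℕ.*-monoˡ-≤ (suc m) x≤s+r) ⟩
      divN (+ (s ℕ.+ r)) (suc m) ≡⟨ divN-homo-+ s r m ⟨
      a + R                     ≤⟨ +-monoʳ-≤ a R≤ε ⟩
      a + ε                     ∎
    ½≤D+Q+a+ε : ½ ≤ divN (+ D) (suc m) + ((Q + a) + ε)
    ½≤D+Q+a+ε = begin
      ½                                              ≤⟨ ½≤divN ⌈n/2⌉≤ ⟩
      divN (+ (D ℕ.+ ((x ℕ.+ s) ℕ.+ r))) (suc m)       ≡⟨ divN-homo-+ D _ m ⟨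
      divN (+ D) (suc m) + divN (+ ((x ℕ.+ s) ℕ.+ r)) (suc m)
        ≡⟨ cong (λ q → divN (+ D) (suc m) + q) (trans (cong (_+ R) (divN-homo-+ x s m)) (divN-homo-+ (x ℕ.+ s) r m)) ⟨
      divN (+ D) (suc m) + ((Q + a) + R)            ≤⟨ +-monoʳ-≤ (divN (+ D) (suc m)) (+-monoʳ-≤ (Q + a) R≤ε) ⟩
      divN (+ D) (suc m) + ((Q + a) + ε)            ∎

open import Data.Nat using (ℕ; _≤_; _<_; ⌊_/2⌋)
open import Data.Integer using (+_) renaming (_+_ to _+ℤ_; _-_ to _-ℤ_)
open import Data.Rational using (ℚ; 0ℚ; ½; _+_; _-_; _*_) renaming (_≤_ to _≤ℚ_; _<_ to _<ℚ_)
open import Data.Fin using (Fin; toℕ)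
open import Data.Fin.Subset using (Subset; _∈_; _∉_; _∩_)
open import Data.Product using (Σ; _×_)
open import Data.Sum using (_⊎_)

open import Data.Nat as ℕ using (zero; suc; z≤n; s≤s)
open import Data.Nat.Properties using (≤-trans; n≤1+n; m≤n*m)
open import Data.Product using (_,_)
open import Relation.Binary.PropositionalEquality using (refl; cong)
open Densities

lemma6p7 : ∀ (ε : ℚ) → 0ℚ <ℚ ε → ∀ (r : ℕ) → 0 < r →
  Σ ℕ λ n₀ → 0 < n₀ × (∀ (n : ℕ) → n₀ ≤ n →
    ∀ (A : Fin r → Subset n) (C : Subset r) →
    (∀ i → MaximalSumFree (A i)) →
    (∀ i → i ∈ C → TypeA (A i)) →
    (∀ i → i ∉ C → TypeB (A i) ⊎ TypeC (A i)) →
    ∀ (k : ℕ) → 0 < k → k ≤ r →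
    (∀ i → toℕ i < k → TypeC (A i)) →
    (∀ i → toℕ i < k → i ∉ C) →
    let a  = divN (aN A C) n
        J₃ = interval n ((+ ⌊ n /2⌋ -ℤ aN A C) +ℤ + 1) (+ ⌊ n /2⌋)
        I₂ = interval n (+ ⌊ n /2⌋ +ℤ + 1) (+ n)
        Q  = sumℚ (firstK r k) (λ i → d (A i ∩ J₃))
    in (Q ≤ℚ a + ε)
       × (((((½ - Q) - a) - ε) ≤ℚ d (interK k A ∩ I₂))
       × (((½ - (+ 2 Data.Rational./ 1) * a) - (+ 2 Data.Rational./ 1) * ε) ≤ℚ (((½ - Q) - a) - ε))))
lemma6p7 ε 0<ε r _ with positive⇒divN 0<ε
... | p , q , refl = suc (r ℕ.* suc q) , s≤s z≤n , λ where
  zero ()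
  (suc m) (s≤s r[1+q]≤m) A C _ _ B⊎C k _ _ C-first ∉C-first →
    let open Estimates.Bounds A C B⊎C k C-first ∉C-first in
    density-bounds {m} {qn} {an} {common} {r} (sumℚ-divN (firstK r k) _ m) (cong (λ σ → divN σ (suc m)) aN≡an)
      qn≤an+r ⌈n/2⌉≤common+qn+an+r
      (divN-≤ r (suc p) m q (≤-trans (≤-trans r[1+q]≤m (n≤1+n m)) (m≤n*m (suc m) (suc p))))
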